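{- Let $(G,T,p)$ be an instance of Directed Vertex Multiway Cut. If $S\in\mathcal{I}_p$ and $v$ is in the exact reverse shadow of $S$, then $S$ is an important $v-T$ separator.
   Context: $G$ is a directed graph with terminals $T$ and distinguished vertices $V^{\infty}(G)\supseteq T$, and $p$ is an integer. For disjoint nonempty $X,Y\subseteq V(G)$, a set $S\subseteq V(G)\setminus(X\cup Y\cup V^{\infty}(G))$ is an $X-Y$ separator if $G\setminus S$ has no directed path from $X$ to $Y$; it is minimal if no proper subset is an $X-Y$ separator. $R^{+}_{H}(X)$ is the set of vertices reachable from $X$ in $H$. A minimal $X-Y$ separator $S$ is important if there is no $X-Y$ separator $S'$ with $|S'|\le |S|$ and $R^{+}_{G\setminus S}(X)\subsetneq R^{+}_{G\setminus S'}(X)$. We write $v-T$ for $\{v\}-T$. $\mathcal{I}_p$ is the collection of all sets $S$ such that $S$ is an important $w-T$ separator of size at most $p$ for some $w\in V(G)\setminus T$. A vertex $v$ is in the exact reverse shadow of $S$ if $S$ is a minimal $v-T$ separator. -}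

module Defs where

open import Data.Nat using (ℕ; _≤_)
open import Data.Fin using (Fin)
open import Data.Fin.Subset using (Subset; _∈_; _∉_; _⊆_; _⊂_; ⁅_⁆; ∣_∣; Nonempty)
open import Data.Product using (Σ; _×_; ∃; ∃-syntax)
open import Relation.Nullary using (¬_)
open import Level using (0ℓ)

Graph : ℕ → Set₁
Graph n = Fin n → Fin n → Set

module _ {n : ℕ} (E : Graph n) where

  -- Directed walk from x to y in G \ S: every vertex of the walk
  -- (including both endpoints) lies outside S.
  data Path (S : Subset n) : Fin n → Fin n → Set where
    here : ∀ {x} → x ∉ S → Path S x x
    step : ∀ {x y z} → x ∉ S → E x y → Path S y z → Path S x z

  Reach : Subset n → Subset n → Fin n → Set
  Reach S X v = ∃[ x ] (x ∈ X × Path S x v)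

  IsSeparator : (Vinf X Y S : Subset n) → Set
  IsSeparator Vinf X Y S =
      Nonempty X × Nonempty Y
    × (∀ v → v ∈ X → v ∉ Y)
    × (∀ v → v ∈ S → v ∉ X × v ∉ Y × v ∉ Vinf)
    × (∀ x y → x ∈ X → y ∈ Y → ¬ Path S x y)

  IsMinimalSeparator : (Vinf X Y S : Subset n) → Set
  IsMinimalSeparator Vinf X Y S =
    IsSeparator Vinf X Y S × (∀ S' → S' ⊂ S → ¬ IsSeparator Vinf X Y S')

  _⊊ₚ_ : (Fin n → Set) → (Fin n → Set) → Set
  P ⊊ₚ Q = (∀ v → P v → Q v) × ∃[ v ] (Q v × ¬ P v)

  IsImportantSeparator : (Vinf X Y S : Subset n) → Set
  IsImportantSeparator Vinf X Y S =
    IsMinimalSeparator Vinf X Y S ×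
    (∀ S' → IsSeparator Vinf X Y S' → ∣ S' ∣ ≤ ∣ S ∣ →
       ¬ (Reach S X ⊊ₚ Reach S' X))

  InIp : (Vinf T : Subset n) (p : ℕ) (S : Subset n) → Set
  InIp Vinf T p S =
    ∃[ w ] (w ∉ T × IsImportantSeparator Vinf ⁅ w ⁆ T S × ∣ S ∣ ≤ p)

  InExactReverseShadow : (Vinf T S : Subset n) (v : Fin n) → Set
  InExactReverseShadow Vinf T S v = IsMinimalSeparator Vinf ⁅ v ⁆ T S

-- Minimality is given, so the content is: no v–T separator S' with
-- |S'| ≤ |S| has C = R⁺_{G∖S}(v) ⊊ B = R⁺_{G∖S'}(v).  If one had, a walk
-- from v to a vertex of B ∖ C leaves C through some s ∈ S ∖ S'
-- (crossing lemma).  A minimal separator is tight: each of its vertices has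
-- an in-neighbour in the region it cuts off.  With A = R⁺_{G∖S}(w), the
-- set S'' = S' ∖ A is then again a w–T separator (pushing lemma: walks in
-- G ∖ S'' starting in A ∪ B stay in A ∪ B); |S''| ≤ |S|, and its reach from
-- w contains A and also s, whose in-neighbour lies in A.  This contradicts
-- the importance of S for w.
--
-- Reachability is not decidable constructively, but every goal above is a
-- negation, so we may assume it decidable (¬¬-decidable) to form S''.
module Submission where

open import Defs
open import Data.Nat using (ℕ; _≤_)
open import Data.Nat.Properties using (≤-trans)
open import Data.Bool.Properties using (T-≡)
open import Data.Fin using (Fin)
open import Data.Fin.Properties using (_≟_; sequence)
open import Data.Fin.Subset using (Subset; _⊆_; ⁅_⁆; _∈_; _∉_; ∣_∣; _-_)
open import Data.Fin.Subset.Properties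
  using (_∈?_; p⊆q⇒∣p∣≤∣q∣; p─q⊆p; x∈p⇒p-x⊂p; x∈p∧x≢y⇒x∈p-y)
open import Data.Vec using (tabulate)
open import Data.Vec.Properties using (lookup∘tabulate; []=⇒lookup; lookup⇒[]=)
open import Data.Product using (∃-syntax; _×_; _,_; proj₁; proj₂)
open import Data.Sum using (_⊎_; inj₁; inj₂)
open import Data.Empty using (⊥)
open import Effect.Monad using (RawMonad)
open import Function.Bundles using (Equivalence)
open import Relation.Nullary using (¬_; Dec; yes; no)
open import Relation.Nullary.Decidable
  using (isYes; toWitness; fromWitness; ¬¬-excluded-middle; _×-dec_; ¬?)
open import Relation.Nullary.Negation using (¬¬-Monad; contradiction)
open import Relation.Binary.PropositionalEquality using (refl; sym; trans)

toSubset : ∀ {n} {P : Fin n → Set} → (∀ x → Dec (P x)) → Subset n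
toSubset P? = tabulate (λ x → isYes (P? x))

module _ {n} {P : Fin n → Set} (P? : ∀ x → Dec (P x)) where

  ∈-toSubset⁺ : ∀ {x} → P x → x ∈ toSubset P?
  ∈-toSubset⁺ {x} Px = lookup⇒[]= x (toSubset P?)
    (trans (lookup∘tabulate _ x) (Equivalence.to T-≡ (fromWitness {a? = P? x} Px)))

  ∈-toSubset⁻ : ∀ {x} → x ∈ toSubset P? → P x
  ∈-toSubset⁻ {x} x∈ = toWitness {a? = P? x}
    (Equivalence.from T-≡ (trans (sym (lookup∘tabulate _ x)) ([]=⇒lookup x∈)))

-- Classically every predicate on a finite set is decidable; constructively
-- this holds under double negation, which suffices when proving ⊥.
¬¬-decidable : ∀ {n} (P : Fin n → Set) → ¬ ¬ (∀ x → Dec (P x))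
¬¬-decidable P = sequence (RawMonad.rawApplicative ¬¬-Monad) (λ _ → ¬¬-excluded-middle)

module _ {n : ℕ} (E : Graph n) where

  path-source∉ : ∀ {S x y} → Path E S x y → x ∉ S
  path-source∉ (here x∉S) = x∉S
  path-source∉ (step x∉S _ _) = x∉S

  path-target∉ : ∀ {S x y} → Path E S x y → y ∉ S
  path-target∉ (here y∉S) = y∉S
  path-target∉ (step _ _ walk) = path-target∉ walk

  path-snoc : ∀ {S x y z} → Path E S x y → E y z → z ∉ S → Path E S x z
  path-snoc (here y∉S) y→z z∉S = step y∉S y→z (here z∉S)
  path-snoc (step x∉S x→x' walk) y→z z∉S = step x∉S x→x' (path-snoc walk y→z z∉S)

  reach-origin : ∀ {S X x} → x ∈ X → x ∉ S → Reach E S X x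
  reach-origin {x = x} x∈X x∉S = x , x∈X , here x∉S

  reach-avoids : ∀ {S X y} → Reach E S X y → y ∉ S
  reach-avoids (_ , _ , walk) = path-target∉ walk

  reach-step : ∀ {S X y z} → Reach E S X y → E y z → z ∉ S → Reach E S X z
  reach-step (x , x∈X , walk) y→z z∉S = x , x∈X , path-snoc walk y→z z∉S

  -- A walk of G ∖ S from X stays inside R⁺_{G∖S}(X), so it is also a walk of
  -- G ∖ S'' whenever S'' is disjoint from that reach set.
  reach-transfer : ∀ {S S'' X} → (∀ {y} → Reach E S X y → y ∉ S'')
                 → ∀ v → Reach E S X v → Reach E S'' X v
  reach-transfer {S} {S''} {X} disjoint _ (x , x∈X , walk) =
    x , x∈X , transfer (reach-origin x∈X (path-source∉ walk)) walk
    where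
    transfer : ∀ {y z} → Reach E S X y → Path E S y z → Path E S'' y z
    transfer Ry (here _) = here (disjoint Ry)
    transfer Ry (step _ y→y' walk') =
      step (disjoint Ry) y→y' (transfer (reach-step Ry y→y' (path-source∉ walk')) walk')

  module _ {Vinf X Y S : Subset n} (sep : IsSeparator E Vinf X Y S) where

    sep-avoids : ∀ v → v ∈ S → v ∉ X × v ∉ Y × v ∉ Vinf
    sep-avoids = proj₁ (proj₂ (proj₂ (proj₂ sep)))

    sep-origin : ∀ {x} → x ∈ X → Reach E S X x
    sep-origin {x} x∈X = reach-origin x∈X (λ x∈S → proj₁ (sep-avoids x x∈S) x∈X)

    sep-blocks : ∀ {y} → Reach E S X y → y ∉ Y
    sep-blocks (x , x∈X , walk) y∈Y = proj₂ (proj₂ (proj₂ (proj₂ sep))) x _ x∈X y∈Y walk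

    sep-replace : ∀ {S'} → (∀ v → v ∈ S' → v ∉ X × v ∉ Y × v ∉ Vinf)
                → (∀ x y → x ∈ X → y ∈ Y → ¬ Path E S' x y) → IsSeparator E Vinf X Y S'
    sep-replace avoids cuts = proj₁ sep , proj₁ (proj₂ sep) , proj₁ (proj₂ (proj₂ sep)) , avoids , cuts

  Tight : (X S : Subset n) → Set
  Tight X S = ∀ {s} → s ∈ S → ¬ ¬ (∃[ c ] (Reach E S X c × E c s))

  -- Minimal separators are tight: otherwise S - s would still separate.
  minimal⇒tight : ∀ {Vinf X Y S} → IsMinimalSeparator E Vinf X Y S → Tight X S
  minimal⇒tight {Vinf} {X} {Y} {S} (sep , minimal) {s} s∈S no-in-neighbour =
    minimal (S - s) (x∈p⇒p-x⊂p s∈S) smaller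
    where
    -- without an edge from R⁺_{G∖S}(X) into s, a walk of G ∖ (S - s) from
    -- that reach set can never leave it, hence never meets Y
    trapped : ∀ {c t} → Reach E S X c → Path E (S - s) c t → t ∉ Y
    trapped Rc (here _) = sep-blocks sep Rc
    trapped {c} Rc (step {y = y} _ c→y walk) with y ∈? S | y ≟ s
    ... | no y∉S  | _        = trapped (reach-step Rc c→y y∉S) walk
    ... | yes _   | yes refl = contradiction (c , Rc , c→y) no-in-neighbour
    ... | yes y∈S | no y≢s   = contradiction (x∈p∧x≢y⇒x∈p-y y∈S y≢s) (path-source∉ walk)

    smaller : IsSeparator E Vinf X Y (S - s)
    smaller = sep-replace sep (λ v v∈ → sep-avoids sep v (p─q⊆p S ⁅ s ⁆ v∈))
                              (λ x y x∈X y∈Y walk → trapped (sep-origin sep x∈X) walk y∈Y)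

  crossing : ∀ {S S' X x u} → Reach E S X x → Path E S' x u → ¬ Reach E S X u
           → ∃[ s ] (s ∈ S × s ∉ S')
  crossing Rx (here _) ¬Ru = contradiction Rx ¬Ru
  crossing {S} Rx (step {y = y} _ x→y walk) ¬Ru with y ∈? S
  ... | yes y∈S = y , y∈S , path-source∉ walk
  ... | no y∉S  = crossing (reach-step Rx x→y y∉S) walk ¬Ru

  module Pushing {Vinf W X T S S' : Subset n}
    (sepW : IsSeparator E Vinf W T S) (tightX : Tight X S)
    (sepX' : IsSeparator E Vinf X T S')
    (C⊆B : ∀ v → Reach E S X v → Reach E S' X v)
    (A? : ∀ v → Dec (Reach E S W v)) where

    private
      A B : Fin n → Set
      A = Reach E S W
      B = Reach E S' X

    S'' : Subset n
    S'' = toSubset (λ v → (v ∈? S') ×-dec ¬? (A? v))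

    S''⊆S' : S'' ⊆ S'
    S''⊆S' v∈ = proj₁ (∈-toSubset⁻ _ v∈)

    A∩S''≡∅ : ∀ {v} → A v → v ∉ S''
    A∩S''≡∅ Av v∈ = proj₂ (∈-toSubset⁻ _ v∈) Av

    ∉S''⇒∉S' : ∀ {v} → ¬ A v → v ∉ S'' → v ∉ S'
    ∉S''⇒∉S' ¬Av v∉S'' v∈S' = v∉S'' (∈-toSubset⁺ _ (v∈S' , ¬Av))

    -- an edge from A ∪ B to a vertex outside A and S' ends (classically) in
    -- B; from A it must enter S, and tightness supplies an edge from C ⊆ B
    into-B : ∀ {x y} → A x ⊎ B x → E x y → ¬ A y → y ∉ S' → ¬ ¬ B y
    into-B (inj₂ Bx) x→y _ y∉S' ¬By = ¬By (reach-step Bx x→y y∉S')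
    into-B {y = y} (inj₁ Ax) x→y ¬Ay y∉S' with y ∈? S
    ... | no y∉S  = contradiction (reach-step Ax x→y y∉S) ¬Ay
    ... | yes y∈S = λ ¬By → tightX y∈S λ (c , Cc , c→y) →
                      ¬By (reach-step (C⊆B c Cc) c→y y∉S')

    -- invariant: a walk of G ∖ S'' starting in A ∪ B stays there, so it
    -- never meets T
    stays : ∀ {x t} → A x ⊎ B x → Path E S'' x t → t ∉ T
    stays (inj₁ Ax) (here _) = sep-blocks sepW Ax
    stays (inj₂ Bx) (here _) = sep-blocks sepX' Bx
    stays AB (step {y = y} _ x→y walk) with A? y
    ... | yes Ay = stays (inj₁ Ay) walk
    ... | no ¬Ay = λ t∈T →
      into-B AB x→y ¬Ay (∉S''⇒∉S' ¬Ay (path-source∉ walk)) λ By →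
        stays (inj₂ By) walk t∈T

    separates : IsSeparator E Vinf W T S''
    separates = sep-replace sepW avoids
      (λ w t w∈W t∈T walk → stays (inj₁ (sep-origin sepW w∈W)) walk t∈T)
      where
      avoids : ∀ v → v ∈ S'' → v ∉ W × v ∉ T × v ∉ Vinf
      avoids v v∈ = (λ v∈W → A∩S''≡∅ (sep-origin sepW v∈W) v∈)
                  , proj₂ (sep-avoids sepX' v (S''⊆S' v∈))

    A⊆reach : ∀ v → A v → Reach E S'' W v
    A⊆reach = reach-transfer A∩S''≡∅

  -- An important W–T separator S that is tight for X admits no X–T separator
  -- S' with |S'| ≤ |S|, reach from X containing that of S, and missing a
  -- vertex of S: pushing S' into S'' would enlarge the reach from W.
  important-not-pushable :
      ∀ {Vinf W X T S S'} → IsImportantSeparator E Vinf W T S → Tight X S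
    → IsSeparator E Vinf X T S' → ∣ S' ∣ ≤ ∣ S ∣
    → (∀ v → Reach E S X v → Reach E S' X v)
    → ∀ {s} → s ∈ S → s ∉ S' → ⊥
  important-not-pushable {S = S} (minW , importantW) tightX sepX' |S'|≤|S|
                         C⊆B {s} s∈S s∉S' =
    ¬¬-decidable (Reach E S _) λ A? →
      let open Pushing (proj₁ minW) tightX sepX' C⊆B A?
          |S''|≤|S| = ≤-trans (p⊆q⇒∣p∣≤∣q∣ S''⊆S') |S'|≤|S|
          s∉S'' = λ s∈S'' → s∉S' (S''⊆S' s∈S'')
      in minimal⇒tight minW s∈S λ (a , Aa , a→s) →
           importantW S'' separates |S''|≤|S|
             (A⊆reach , s , reach-step (A⊆reach a Aa) a→s s∉S''
             , λ As → reach-avoids As s∈S)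

lemma10 : (n : ℕ) (E : Graph n) (T Vinf : Subset n) (p : ℕ)
    → T ⊆ Vinf
    → (S : Subset n) → InIp E Vinf T p S
    → (v : Fin n) → InExactReverseShadow E Vinf T S v
    → IsImportantSeparator E Vinf ⁅ v ⁆ T S
lemma10 n E T Vinf p _ S (_ , _ , importantW , _) v minV = minV , no-larger-reach
  where
  -- a larger reach from v would force a vertex of S ∖ S' (crossing lemma),
  -- which the importance of S for w rules out
  no-larger-reach : ∀ S' → IsSeparator E Vinf ⁅ v ⁆ T S' → ∣ S' ∣ ≤ ∣ S ∣
                  → ¬ (_⊊ₚ_ E (Reach E S ⁅ v ⁆) (Reach E S' ⁅ v ⁆))
  no-larger-reach S' sepV' |S'|≤|S| (C⊆B , u , (v' , v'∈ , walk) , ¬Cu) =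
    let (s , s∈S , s∉S') = crossing E (sep-origin E (proj₁ minV) v'∈) walk ¬Cu
    in important-not-pushable E importantW (minimal⇒tight E minV) sepV' |S'|≤|S|
         C⊆B s∈S s∉S'
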